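{- Let $n\ge 3$ be odd. Let $J_n$ be the graph with vertex set $\{a_1,\ldots,a_n,b_1,\ldots,b_n,c_1,\ldots,c_n\}$ and edges $\{a_i,a_{i+1}\}$ and $\{b_i,b_{i+1}\}$ for $1\le i\le n$ (indices taken modulo $n$), and $\{a_i,b_i\}$, $\{a_i,c_i\}$, $\{c_i,b_i\}$ for $1\le i\le n$. Then $J_n$ is a Harris graph.
   Context: All graphs are finite, simple and undirected. A graph $G$ is tough if it is connected and for every nonempty set $S$ of vertices, the number of connected components of $G-S$ is at most $|S|$. A graph is Eulerian if it is connected and every vertex has even degree. A graph is Hamiltonian if it contains a spanning cycle. A Harris graph is a graph that is tough, Eulerian, and not Hamiltonian. -}

module Defs where

open import Data.Nat using (ℕ; _+_; _*_; _≤_; _≡ᵇ_)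
import Data.Nat as ℕ
open import Data.Nat.ListAction using (sum)
open import Data.Nat.Divisibility using (_∣_)
open import Data.Fin using (Fin; toℕ; remQuot; zero; suc)
open import Data.Fin.Subset using (Subset; _∉_; Nonempty; ∣_∣)
open import Data.Bool using (Bool; true; false; if_then_else_; _∨_; _∧_)
open import Data.List using (List; map; allFin)
open import Data.Product using (Σ; ∃; _×_; _,_)
open import Function.Definitions using (Injective)
open import Relation.Binary.PropositionalEquality using (_≡_; _≢_)
open import Relation.Nullary using (¬_)

-- A finite simple graph on the vertex set Fin N, given by a Boolean
-- adjacency function (for the graph J_n below it is symmetric and irreflexive).
record Graph (N : ℕ) : Set where
  field
    adj : Fin N → Fin N → Bool
open Graph public

module _ {N : ℕ} (G : Graph N) where

  -- Walks in the subgraph of G induced by the vertices satisfying P.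
  data Walk (P : Fin N → Set) : Fin N → Fin N → Set where
    here : ∀ {u} → P u → Walk P u u
    step : ∀ {u v w} → P u → adj G u v ≡ true → Walk P v w → Walk P u w

  everything : Fin N → Set
  everything _ = Data.Unit.⊤ where import Data.Unit

  Connected : Set
  Connected = ∀ u v → Walk everything u v

  outside : Subset N → Fin N → Set
  outside S v = v ∉ S

  -- G - S has at least k connected components: there are k vertices of G - S,
  -- pairwise in different components of G - S.
  AtLeastComponents : Subset N → ℕ → Set
  AtLeastComponents S k =
    Σ (Fin k → Fin N) λ f →
      (∀ i → f i ∉ S) × (∀ i j → i ≢ j → ¬ Walk (outside S) (f i) (f j))

  Tough : Set
  Tough = Connected ×
    (∀ (S : Subset N) → Nonempty S → ∀ k → AtLeastComponents S k → k ≤ ∣ S ∣)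

  degree : Fin N → ℕ
  degree u = sum (map (λ v → if adj G u v then 1 else 0) (allFin N))

  Eulerian : Set
  Eulerian = Connected × (∀ v → 2 ∣ degree v)

  -- A spanning cycle: an enumeration f 0, f 1, ..., f (N-1) of all vertices
  -- (injective, hence bijective) with consecutive vertices adjacent and
  -- f (N-1) adjacent to f 0; a cycle needs at least 3 vertices.
  Hamiltonian : Set
  Hamiltonian = 3 ≤ N × Σ (Fin N → Fin N) λ f → Injective _≡_ _≡_ f ×
    (∀ i j → ℕ.suc (toℕ i) ≡ toℕ j → adj G (f i) (f j) ≡ true) ×
    (∀ i j → ℕ.suc (toℕ i) ≡ N → toℕ j ≡ ℕ.zero → adj G (f i) (f j) ≡ true)

  Harris : Set
  Harris = Tough × Eulerian × ¬ Hamiltonian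

-- The graph J_n.  Vertex v : Fin (3 * n) is decoded as remQuot n v = (t , i)
-- with t : Fin 3 (0 = a, 1 = b, 2 = c) and i : Fin n, i.e. v is a_{i+1},
-- b_{i+1} or c_{i+1} (0-based index i).

nextMod : (n : ℕ) → Fin n → Fin n → Bool
nextMod n i j = (ℕ.suc (toℕ i) ≡ᵇ toℕ j) ∨ ((ℕ.suc (toℕ i) ≡ᵇ n) ∧ (toℕ j ≡ᵇ 0))

cycAdj : (n : ℕ) → Fin n → Fin n → Bool
cycAdj n i j = nextMod n i j ∨ nextMod n j i

sameIdx : {n : ℕ} → Fin n → Fin n → Bool
sameIdx i j = toℕ i ≡ᵇ toℕ j

adjJ : (n : ℕ) → Fin 3 × Fin n → Fin 3 × Fin n → Bool
adjJ n (zero , i) (zero , j) = cycAdj n i j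
adjJ n (suc zero , i) (suc zero , j) = cycAdj n i j
adjJ n (suc (suc zero) , i) (suc (suc zero) , j) = false
adjJ n (_ , i) (_ , j) = sameIdx i j   -- a_i b_i, a_i c_i, c_i b_i (both orders)

J : (n : ℕ) → Graph (3 * n)
J n = record { adj = λ u v → adjJ n (remQuot n u) (remQuot n v) }

-- J n is connected through the cycle a₁ … aₙ, and its vertices have degrees 4, 4 and 2.
--
-- Toughness: mark every vertex u of J n − S by an element of S so that vertices with
-- equal marks are joined in J n − S.  If S misses a whole a- or b-row, J n − S is connected
-- and one mark suffices.  Otherwise u walks (from c_i first to a free a_i or b_i) along its
-- row to the last vertex before S and is marked by the element of S that follows; a vertex
-- c_i cut off by a_i, b_i ∈ S is marked a_i if a_{i-1} ∈ S (so no a-walk claims a_i) and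
-- b_i otherwise, in which case b-walks stopping at b_{i-1} step over to a_{i-1} and are
-- marked a_i instead.
--
-- Non-Hamiltonicity: a Hamiltonian cycle passes each c_i as a_i c_i b_i, so from a_i it
-- continues to a_{i±1}.  These edges form a perfect matching of the odd cycle a₁ … aₙ.

module Submission where

open import Defs
import Data.Nat.Properties as ℕP
open import Algebra.Properties.CommutativeMonoid.Sum ℕP.+-0-commutativeMonoid
  using (sum; ∑-distrib-+; sum-remove; sum-cong-≗; sum-replicate-zero)
open import Data.Bool using (Bool; true; false; T; not; if_then_else_; _∨_; _∧_)
open import Data.Bool.Properties using (∨-comm; ¬-not; not-involutive; not-¬; T-≡; T-∨; T-∧)
open import Data.Empty using (⊥; ⊥-elim)
open import Data.Fin as Fin using (Fin; zero; suc; toℕ; fromℕ; fromℕ<; inject₁; punchIn; punchOut; combine; remQuot)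
import Data.Fin.Properties as FinP
open import Data.Fin.Patterns using (0F; 1F; 2F)
open import Data.Fin.Subset using (Subset; _∈_; _∉_; _-_; ∣_∣; Nonempty)
open import Data.Fin.Subset.Properties using (x∈p⇒∣p-x∣<∣p∣; x∈p∧x≢y⇒x∈p-y; _∈?_)
open import Data.List as List using (List; []; _∷_; length; allFin; tabulate)
import Data.List.Properties as ListP
open import Data.Nat as ℕ using (ℕ; zero; suc; _+_; _*_; _∸_; _≤_; _<_; _≡ᵇ_; z≤n; s≤s)
import Data.Nat.ListAction as ListAction
open import Data.Nat.Divisibility using (_∣_; divides; ∣m∣n⇒∣m+n; ∣-refl)
open import Data.Product using (Σ; ∃; _×_; _,_; proj₁; proj₂)
open import Data.Sum using (_⊎_; inj₁; inj₂)
import Data.Sum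
open import Data.Unit using (tt)
open import Function using (_∘_; id; case_of_)
open import Function.Bundles using (Equivalence)
open import Function.Definitions using (Injective)
open import Relation.Binary.PropositionalEquality
  using (_≡_; _≢_; refl; sym; trans; cong; cong₂; subst; subst₂; module ≡-Reasoning)
open import Relation.Nullary using (¬_; yes; no; does)
open import Relation.Nullary.Decidable using (dec-true; dec-false)

-- Cyclic order on Fin (suc M)

¬2∣n⇒n≡1+q+q : ∀ n → ¬ (2 ∣ n) → ∃ λ q → n ≡ suc (q + q)
¬2∣n⇒n≡1+q+q zero ¬2∣n = ⊥-elim (¬2∣n (divides 0 refl))
¬2∣n⇒n≡1+q+q (suc zero) _ = 0 , refl
¬2∣n⇒n≡1+q+q (suc (suc n)) ¬2∣n with ¬2∣n⇒n≡1+q+q n (¬2∣n ∘ ∣m∣n⇒∣m+n ∣-refl)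
... | q , refl = suc q , cong (ℕ.suc ∘ ℕ.suc) (sym (ℕP.+-suc q q))

module Cyclic {M : ℕ} where

  next : Fin (suc M) → Fin (suc M)
  next i with toℕ i ℕ.<? M
  ... | yes i<M = fromℕ< (s≤s i<M)
  ... | no _    = zero

  prev : Fin (suc M) → Fin (suc M)
  prev zero    = fromℕ M
  prev (suc i) = inject₁ i

  NextStep : ℕ → ℕ → Set
  NextStep a b = (a < M × b ≡ suc a) ⊎ (a ≡ M × b ≡ 0)

  next-step : ∀ i → NextStep (toℕ i) (toℕ (next i))
  next-step i with toℕ i ℕ.<? M
  ... | yes i<M = inj₁ (i<M , FinP.toℕ-fromℕ< (s≤s i<M))
  ... | no  i≮M = inj₂ (ℕP.≤-antisym (ℕ.s≤s⁻¹ (FinP.toℕ<n i)) (ℕP.≮⇒≥ i≮M) , refl)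

  next-injective : ∀ {i j} → next i ≡ next j → i ≡ j
  next-injective {i} {j} eq with next-step i | next-step j | cong toℕ eq
  ... | inj₁ (_ , a) | inj₁ (_ , b) | e = FinP.toℕ-injective (ℕP.suc-injective (trans (sym a) (trans e b)))
  ... | inj₁ (_ , a) | inj₂ (_ , b) | e with () ← trans (sym a) (trans e b)
  ... | inj₂ (_ , a) | inj₁ (_ , b) | e with () ← trans (sym a) (trans e b)
  ... | inj₂ (a , _) | inj₂ (b , _) | _ = FinP.toℕ-injective (trans a (sym b))

  next-prev : ∀ i → next (prev i) ≡ i
  next-prev zero with next-step (fromℕ M)
  ... | inj₁ (M<M , _) = ⊥-elim (ℕP.<-irrefl (FinP.toℕ-fromℕ M) M<M)
  ... | inj₂ (_ , e)   = FinP.toℕ-injective e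
  next-prev (suc i) with next-step (inject₁ i)
  ... | inj₁ (_ , e) = FinP.toℕ-injective (trans e (cong suc (FinP.toℕ-inject₁ i)))
  ... | inj₂ (e , _) = ⊥-elim (ℕP.<-irrefl (trans (sym (FinP.toℕ-inject₁ i)) e) (FinP.toℕ<n i))

  prev-next : ∀ i → prev (next i) ≡ i
  prev-next i = next-injective (next-prev (next i))

  private
    two-steps-differ : ∀ {a b c} → 2 ≤ M → NextStep a b → NextStep b c → c ≢ a
    two-steps-differ _ (inj₁ (_ , refl)) (inj₁ (_ , refl)) e = ℕP.m+1+n≢m _ (trans (ℕP.+-comm _ 2) e)
    two-steps-differ (s≤s ()) (inj₁ (_ , refl)) (inj₂ (refl , refl)) refl
    two-steps-differ (s≤s ()) (inj₂ (refl , refl)) (inj₁ (_ , refl)) refl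

    three-steps-differ : ∀ {a b c d} → 3 ≤ M → NextStep a b → NextStep b c → NextStep c d → d ≢ a
    three-steps-differ _ (inj₁ (_ , refl)) (inj₁ (_ , refl)) (inj₁ (_ , refl)) e =
      ℕP.m+1+n≢m _ (trans (ℕP.+-comm _ 3) e)
    three-steps-differ (s≤s (s≤s ())) (inj₁ (_ , refl)) (inj₁ (_ , refl)) (inj₂ (refl , refl)) refl
    three-steps-differ (s≤s (s≤s ())) (inj₁ (_ , refl)) (inj₂ (refl , refl)) (inj₁ (_ , refl)) refl
    three-steps-differ (s≤s (s≤s ())) (inj₂ (refl , refl)) (inj₁ (_ , refl)) (inj₁ (_ , refl)) refl

  next²≢id : 2 ≤ M → ∀ i → next (next i) ≢ i
  next²≢id 2≤M i e = two-steps-differ 2≤M (next-step i) (next-step (next i)) (cong toℕ e)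

  next³≢id : 3 ≤ M → ∀ i → next (next (next i)) ≢ i
  next³≢id 3≤M i e =
    three-steps-differ 3≤M (next-step i) (next-step (next i)) (next-step (next (next i))) (cong toℕ e)

  next≢prev : 2 ≤ M → ∀ i → next i ≢ prev i
  next≢prev 2≤M i e = next²≢id 2≤M (prev i) (trans (cong next (next-prev i)) e)

  Consecutive : Fin (suc M) → Fin (suc M) → Set
  Consecutive i j = j ≡ next i ⊎ i ≡ next j

  consecutive-sym : ∀ {i j} → Consecutive i j → Consecutive j i
  consecutive-sym (inj₁ e) = inj₂ e
  consecutive-sym (inj₂ e) = inj₁ e

  consecutive⇒next⊎prev : ∀ {i j} → Consecutive i j → j ≡ next i ⊎ j ≡ prev i
  consecutive⇒next⊎prev (inj₁ e)    = inj₁ e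
  consecutive⇒next⊎prev (inj₂ refl) = inj₂ (sym (prev-next _))

  next^ : ℕ → Fin (suc M) → Fin (suc M)
  next^ zero    i = i
  next^ (suc k) i = next^ k (next i)

  next^-suc : ∀ k i → next^ (suc k) i ≡ next (next^ k i)
  next^-suc zero    i = refl
  next^-suc (suc k) i = next^-suc k (next i)

  next^-+ : ∀ k l i → next^ (k + l) i ≡ next^ l (next^ k i)
  next^-+ zero    l i = refl
  next^-+ (suc k) l i = next^-+ k l (next i)

  next^-from-zero : ∀ k (k<1+M : k < suc M) → next^ k zero ≡ fromℕ< k<1+M
  next^-from-zero zero    _      = refl
  next^-from-zero (suc k) 1+k<1+M = from-step (next-step (fromℕ< k<1+M))
    where
    k<1+M : k < suc M
    k<1+M = ℕP.<-trans (ℕP.n<1+n k) 1+k<1+M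
    from-step : NextStep (toℕ (fromℕ< k<1+M)) (toℕ (next (fromℕ< k<1+M))) →
                next^ (suc k) zero ≡ fromℕ< 1+k<1+M
    from-step (inj₁ (_ , e)) = begin
      next^ (suc k) zero      ≡⟨ next^-suc k zero ⟩
      next (next^ k zero)     ≡⟨ cong next (next^-from-zero k k<1+M) ⟩
      next (fromℕ< k<1+M)     ≡⟨ FinP.toℕ-injective (trans e (trans (cong suc (FinP.toℕ-fromℕ< k<1+M))
                                                                     (sym (FinP.toℕ-fromℕ< 1+k<1+M)))) ⟩
      fromℕ< 1+k<1+M          ∎
      where open ≡-Reasoning
    from-step (inj₂ (e , _)) = ⊥-elim (ℕP.<-irrefl (trans (sym (FinP.toℕ-fromℕ< k<1+M)) e) (ℕ.s≤s⁻¹ 1+k<1+M))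

  next^-to-zero : ∀ d i → toℕ i + d ≡ M → next^ (suc d) i ≡ zero
  next^-to-zero d i e with next-step i
  next^-to-zero zero    i e | inj₁ (i<M , _) = ⊥-elim (ℕP.<-irrefl (trans (sym (ℕP.+-identityʳ _)) e) i<M)
  next^-to-zero (suc d) i e | inj₁ (_ , s)   =
    next^-to-zero d (next i) (trans (cong (_+ d) s) (trans (sym (ℕP.+-suc _ d)) e))
  next^-to-zero zero    i e | inj₂ (_ , s)   = FinP.toℕ-injective s
  next^-to-zero (suc d) i e | inj₂ (i≡M , _) = ⊥-elim (ℕP.m+1+n≢m M (trans (cong (_+ suc d) (sym i≡M)) e))

  reachable : ∀ i j → ∃ λ d → next^ d i ≡ j
  reachable i j = suc (M ∸ toℕ i) + toℕ j , (begin
    next^ (suc (M ∸ toℕ i) + toℕ j) i        ≡⟨ next^-+ (suc (M ∸ toℕ i)) (toℕ j) i ⟩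
    next^ (toℕ j) (next^ (suc (M ∸ toℕ i)) i) ≡⟨ cong (next^ (toℕ j)) (next^-to-zero _ i (ℕP.m+[n∸m]≡n (ℕ.s≤s⁻¹ (FinP.toℕ<n i)))) ⟩
    next^ (toℕ j) zero                        ≡⟨ next^-from-zero (toℕ j) (FinP.toℕ<n j) ⟩
    fromℕ< (FinP.toℕ<n j)                     ≡⟨ FinP.fromℕ<-toℕ j (FinP.toℕ<n j) ⟩
    j                                         ∎)
    where open ≡-Reasoning

  odd-cycle-not-2-colourable : ¬ (2 ∣ suc M) → (colour : Fin (suc M) → Bool) →
                               ¬ (∀ i → colour (next i) ≡ not (colour i))
  odd-cycle-not-2-colourable odd colour flips with ¬2∣n⇒n≡1+q+q (suc M) odd
  ... | q , 1+M≡1+q+q = not-¬ refl (begin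
    colour zero                             ≡⟨ cong colour (sym (next^-to-zero M zero refl)) ⟩
    colour (next^ (suc M) zero)             ≡⟨ cong (λ k → colour (next^ k zero)) 1+M≡1+q+q ⟩
    colour (next^ (suc (q + q)) zero)       ≡⟨ cong colour (next^-suc (q + q) zero) ⟩
    colour (next (next^ (q + q) zero))      ≡⟨ flips _ ⟩
    not (colour (next^ (q + q) zero))       ≡⟨ cong not (even-steps q zero) ⟩
    not (colour zero)                       ∎)
    where
    open ≡-Reasoning
    even-steps : ∀ q i → colour (next^ (q + q) i) ≡ colour i
    even-steps zero    i = refl
    even-steps (suc q) i = begin
      colour (next^ (suc q + suc q) i)         ≡⟨ cong (λ k → colour (next^ (suc k) i)) (ℕP.+-suc q q) ⟩
      colour (next^ (q + q) (next (next i)))   ≡⟨ even-steps q (next (next i)) ⟩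
      colour (next (next i))                   ≡⟨ flips (next i) ⟩
      not (colour (next i))                    ≡⟨ cong not (flips i) ⟩
      not (not (colour i))                     ≡⟨ not-involutive _ ⟩
      colour i                                 ∎

  odd-cycle-has-no-perfect-matching : 2 ≤ M → ¬ (2 ∣ suc M) →
    (partner : Fin (suc M) → Fin (suc M)) →
    (∀ i → Consecutive i (partner i)) → (∀ i → partner (partner i) ≡ i) → ⊥
  odd-cycle-has-no-perfect-matching 2≤M odd partner consecutive involutive =
    odd-cycle-not-2-colourable odd matchedForward flips
    where
    matchedForward : Fin (suc M) → Bool
    matchedForward i = does (partner i Fin.≟ next i)

    flips : ∀ i → matchedForward (next i) ≡ not (matchedForward i)
    flips i with consecutive (next i)
    ... | inj₁ p≡n² = begin
      matchedForward (next i)  ≡⟨ dec-true (partner (next i) Fin.≟ next (next i)) p≡n² ⟩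
      true                     ≡⟨ cong not (sym (dec-false (partner i Fin.≟ next i) p≢n)) ⟩
      not (matchedForward i)   ∎
      where
      open ≡-Reasoning
      p≢n : partner i ≢ next i
      p≢n p≡n = next²≢id 2≤M i (trans (sym p≡n²) (trans (cong partner (sym p≡n)) (involutive i)))
    ... | inj₂ n≡np = begin
      matchedForward (next i)  ≡⟨ dec-false (partner (next i) Fin.≟ next (next i)) p≢n² ⟩
      false                    ≡⟨ cong not (sym (dec-true (partner i Fin.≟ next i) p≡n)) ⟩
      not (matchedForward i)   ∎
      where
      open ≡-Reasoning
      p≡i : partner (next i) ≡ i
      p≡i = next-injective (sym n≡np)
      p≢n² : partner (next i) ≢ next (next i)
      p≢n² e = next²≢id 2≤M i (sym (trans (sym p≡i) e))
      p≡n : partner i ≡ next i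
      p≡n = trans (cong partner (sym p≡i)) (involutive (next i))

-- Counting

injective⇒≤∣p∣ : ∀ {k N} (S : Subset N) (h : Fin k → Fin N) →
                  Injective _≡_ _≡_ h → (∀ i → h i ∈ S) → k ≤ ∣ S ∣
injective⇒≤∣p∣ {zero}  S h _     _   = z≤n
injective⇒≤∣p∣ {suc k} S h h-inj h∈S =
  ℕP.≤-trans (s≤s (injective⇒≤∣p∣ (S - h zero) (h ∘ suc) (FinP.suc-injective ∘ h-inj) h∘suc∈S-h₀))
             (x∈p⇒∣p-x∣<∣p∣ (h∈S zero))
  where
  h∘suc∈S-h₀ : ∀ i → h (suc i) ∈ S - h zero
  h∘suc∈S-h₀ i = x∈p∧x≢y⇒x∈p-y (h∈S (suc i)) (λ e → case h-inj e of λ ())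

injective⇒surjective : ∀ {N} (f : Fin N → Fin N) → Injective _≡_ _≡_ f → ∀ v → ∃ λ p → f p ≡ v
injective⇒surjective {zero}  f _     ()
injective⇒surjective {suc N} f f-inj v with FinP.any? (λ p → f p Fin.≟ v)
... | yes hit  = hit
... | no  miss = ⊥-elim (ℕP.<-irrefl refl (FinP.injective⇒≤ g-inj))
  where
  v≢f : ∀ p → v ≢ f p
  v≢f p e = miss (p , sym e)
  g : Fin (suc N) → Fin N
  g p = punchOut (v≢f p)
  g-inj : Injective _≡_ _≡_ g
  g-inj e = f-inj (FinP.punchOut-injective (v≢f _) (v≢f _) e)

indicator : Bool → ℕ
indicator b = if b then 1 else 0

δ : ∀ {N} → Fin N → Fin N → ℕ
δ x y = indicator (does (x Fin.≟ y))

δ-refl : ∀ {N} (x : Fin N) → δ x x ≡ 1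
δ-refl x = cong indicator (dec-true (x Fin.≟ x) refl)

δ-≢ : ∀ {N} {x y : Fin N} → x ≢ y → δ x y ≡ 0
δ-≢ {x = x} {y} x≢y = cong indicator (dec-false (x Fin.≟ y) x≢y)

∑δ≡1 : ∀ {N} (x : Fin N) → sum (δ x) ≡ 1
∑δ≡1 {suc N} x = begin
  sum (δ x)                               ≡⟨ sum-remove {i = x} (δ x) ⟩
  δ x x + sum (δ x ∘ punchIn x)            ≡⟨ cong₂ _+_ (δ-refl x) (sum-cong-≗ {N} (λ j → δ-≢ (FinP.punchInᵢ≢i x j ∘ sym))) ⟩
  1 + sum {N} (λ _ → 0)                    ≡⟨ cong suc (sum-replicate-zero N) ⟩
  1                                        ∎
  where open ≡-Reasoning

multiplicity : ∀ {N} → List (Fin N) → Fin N → ℕ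
multiplicity xs y = ListAction.sum (List.map (λ x → δ x y) xs)

∑multiplicity≡length : ∀ {N} (xs : List (Fin N)) → sum (multiplicity xs) ≡ length xs
∑multiplicity≡length {N} []       = sum-replicate-zero N
∑multiplicity≡length     (x ∷ xs) = begin
  sum (λ y → δ x y + multiplicity xs y)   ≡⟨ ∑-distrib-+ (δ x) (multiplicity xs) ⟩
  sum (δ x) + sum (multiplicity xs)        ≡⟨ cong₂ _+_ (∑δ≡1 x) (∑multiplicity≡length xs) ⟩
  suc (length xs)                          ∎
  where open ≡-Reasoning

sum-map-allFin : ∀ {N} (h : Fin N → ℕ) → ListAction.sum (List.map h (allFin N)) ≡ sum h
sum-map-allFin h = trans (cong ListAction.sum (ListP.map-tabulate id h)) (sum-tabulate h)
  where
  sum-tabulate : ∀ {N} (h : Fin N → ℕ) → ListAction.sum (tabulate h) ≡ sum h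
  sum-tabulate {zero}  h = refl
  sum-tabulate {suc N} h = cong (h zero +_) (sum-tabulate (h ∘ suc))

module _ {N} (G : Graph N) where

  degree≡length : ∀ u (xs : List (Fin N)) →
                  (∀ v → indicator (adj G u v) ≡ multiplicity xs v) → degree G u ≡ length xs
  degree≡length u xs adj≗mult = begin
    degree G u                                  ≡⟨ sum-map-allFin (indicator ∘ adj G u) ⟩
    sum (indicator ∘ adj G u)                   ≡⟨ sum-cong-≗ {N} adj≗mult ⟩
    sum (multiplicity xs)                       ≡⟨ ∑multiplicity≡length xs ⟩
    length xs                                   ∎
    where open ≡-Reasoning

-- Walks, components and Hamiltonian cycles

SymmetricAdjacency : ∀ {N} → Graph N → Set
SymmetricAdjacency {N} G = ∀ (u v : Fin N) → adj G u v ≡ true → adj G v u ≡ true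

module _ {N} {G : Graph N} {P : Fin N → Set} where

  walk-start : ∀ {u v} → Walk G P u v → P u
  walk-start (here pu)     = pu
  walk-start (step pu _ _) = pu

  infixr 5 _++_
  _++_ : ∀ {u v w} → Walk G P u v → Walk G P v w → Walk G P u w
  here _       ++ q = q
  step pu e p  ++ q = step pu e (p ++ q)

  edge : ∀ {u v} → P u → P v → adj G u v ≡ true → Walk G P u v
  edge pu pv e = step pu e (here pv)

  reverse : SymmetricAdjacency G → ∀ {u v} → Walk G P u v → Walk G P v u
  reverse G-sym (here pu)     = here pu
  reverse G-sym (step pu e p) = reverse G-sym p ++ edge (walk-start p) pu (G-sym _ _ e)

-- If every vertex of G − S is marked by some x ∈ S such that it reaches anchor x inside G − S,
-- then vertices with equal marks lie in one component, so distinct components get distinct marks.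
components≤∣S∣ : ∀ {N} (G : Graph N) → SymmetricAdjacency G → (S : Subset N) (anchor : Fin N → Fin N) →
  (∀ u → u ∉ S → Σ (Fin N) λ x → x ∈ S × Walk G (outside G S) u (anchor x)) →
  ∀ k → AtLeastComponents G S k → k ≤ ∣ S ∣
components≤∣S∣ G G-sym S anchor marked k (rep , rep∉S , separated) =
  injective⇒≤∣p∣ S mark mark-injective (λ i → proj₁ (proj₂ (marked (rep i) (rep∉S i))))
  where
  mark : Fin k → Fin _
  mark i = proj₁ (marked (rep i) (rep∉S i))
  toAnchor : ∀ i → Walk G (outside G S) (rep i) (anchor (mark i))
  toAnchor i = proj₂ (proj₂ (marked (rep i) (rep∉S i)))
  mark-injective : Injective _≡_ _≡_ mark
  mark-injective {i} {j} eq with i Fin.≟ j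
  ... | yes i≡j = i≡j
  ... | no  i≢j = ⊥-elim (separated i j i≢j
          (toAnchor i ++ reverse G-sym (subst (Walk G _ (rep j) ∘ anchor) (sym eq) (toAnchor j))))

module HamiltonianCycle {M} (G : Graph (suc M)) (G-sym : SymmetricAdjacency G)
  (f : Fin (suc M) → Fin (suc M)) (f-injective : Injective _≡_ _≡_ f)
  (f-step : ∀ i j → suc (toℕ i) ≡ toℕ j → adj G (f i) (f j) ≡ true)
  (f-wrap : ∀ i j → suc (toℕ i) ≡ suc M → toℕ j ≡ 0 → adj G (f i) (f j) ≡ true) where

  open Cyclic {M}

  adj-next : ∀ p → adj G (f p) (f (next p)) ≡ true
  adj-next p with next-step p
  ... | inj₁ (_ , e)   = f-step p (next p) (sym e)
  ... | inj₂ (p≡M , e) = f-wrap p (next p) (cong suc p≡M) e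

  position : Fin (suc M) → Fin (suc M)
  position v = proj₁ (injective⇒surjective f f-injective v)

  f-position : ∀ v → f (position v) ≡ v
  f-position v = proj₂ (injective⇒surjective f f-injective v)

  position-f : ∀ p → position (f p) ≡ p
  position-f p = f-injective (f-position (f p))

  CycleNeighbours : Fin (suc M) → Fin (suc M) → Set
  CycleNeighbours x y = Consecutive (position x) (position y)

  cycleNeighbours-sym : ∀ {x y} → CycleNeighbours x y → CycleNeighbours y x
  cycleNeighbours-sym = consecutive-sym

  cycleNeighbours⇒adj : ∀ {x y} → CycleNeighbours x y → adj G x y ≡ true
  cycleNeighbours⇒adj {x} {y} (inj₁ e) =
    subst₂ (λ a b → adj G a b ≡ true) (f-position x) (trans (cong f (sym e)) (f-position y)) (adj-next (position x))
  cycleNeighbours⇒adj {x} {y} (inj₂ e) =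
    G-sym _ _ (subst₂ (λ a b → adj G a b ≡ true) (f-position y) (trans (cong f (sym e)) (f-position x)) (adj-next (position y)))

  record Continuation (a b c : Fin (suc M)) : Set where
    field
      beyond           : Fin (suc M)
      beyond-neighbour : CycleNeighbours a beyond
      beyond≢b         : beyond ≢ b
      beyond≢c         : beyond ≢ c
      neighbours-of-a  : ∀ w → CycleNeighbours a w → w ≡ c ⊎ w ≡ beyond

  -- The cycle passes a vertex c adjacent only to a and b as a c b; beyond a it continues to a
  -- vertex other than b because the cycle is longer than three.
  through-degree-two : 3 ≤ M → ∀ {a b c} → (∀ w → adj G c w ≡ true → w ≡ a ⊎ w ≡ b) → Continuation a b c
  through-degree-two 3≤M {a} {b} {c} c-adj = leave (c-adj _ adj-to-next) (c-adj _ adj-to-prev)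
    where
    γ : Fin (suc M)
    γ = position c
    2≤M : 2 ≤ M
    2≤M = ℕP.≤-trans (ℕP.n≤1+n 2) 3≤M
    at : ∀ {w p} → position w ≡ p → w ≡ f p
    at {w} e = trans (sym (f-position w)) (cong f e)
    c≡fγ : c ≡ f γ
    c≡fγ = at refl
    adj-to-next : adj G c (f (next γ)) ≡ true
    adj-to-next = cycleNeighbours⇒adj (inj₁ (position-f (next γ)))
    adj-to-prev : adj G c (f (prev γ)) ≡ true
    adj-to-prev = cycleNeighbours⇒adj (inj₂ (trans (sym (next-prev γ)) (cong next (sym (position-f (prev γ))))))
    next²prev² : next (next (prev (prev γ))) ≡ γ
    next²prev² = trans (cong next (next-prev (prev γ))) (next-prev γ)

    leave : f (next γ) ≡ a ⊎ f (next γ) ≡ b → f (prev γ) ≡ a ⊎ f (prev γ) ≡ b → Continuation a b c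
    leave (inj₁ n↦a) (inj₁ p↦a) = ⊥-elim (next≢prev 2≤M γ (f-injective (trans n↦a (sym p↦a))))
    leave (inj₂ n↦b) (inj₂ p↦b) = ⊥-elim (next≢prev 2≤M γ (f-injective (trans n↦b (sym p↦b))))
    leave (inj₁ n↦a) (inj₂ p↦b) = record
      { beyond           = f (next (next γ))
      ; beyond-neighbour = inj₁ (trans (position-f _) (cong next (sym pa)))
      ; beyond≢b         = λ e → next³≢id 3≤M γ (trans (cong next (f-injective (trans e (sym p↦b)))) (next-prev γ))
      ; beyond≢c         = λ e → next²≢id 2≤M γ (f-injective (trans e c≡fγ))
      ; neighbours-of-a  = λ w cn → Data.Sum.map (λ e → trans (at (trans e (trans (cong prev pa) (prev-next γ)))) (sym c≡fγ))
                            (λ e → at (trans e (cong next pa)))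
                            (Data.Sum.swap (consecutive⇒next⊎prev cn))
      }
      where
      pa : position a ≡ next γ
      pa = trans (cong position (sym n↦a)) (position-f (next γ))
    leave (inj₂ n↦b) (inj₁ p↦a) = record
      { beyond           = f (prev (prev γ))
      ; beyond-neighbour = inj₂ (trans pa (sym (trans (cong next (position-f _)) (next-prev (prev γ)))))
      ; beyond≢b         = λ e → next³≢id 3≤M γ (trans (cong (next ∘ next) (sym (f-injective (trans e (sym n↦b))))) next²prev²)
      ; beyond≢c         = λ e → next²≢id 2≤M γ (trans (cong (next ∘ next) (sym (f-injective (trans e c≡fγ)))) next²prev²)
      ; neighbours-of-a  = λ w cn → Data.Sum.map (λ e → trans (at (trans e (trans (cong next pa) (next-prev γ)))) (sym c≡fγ))
                            (λ e → at (trans e (cong prev pa)))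
                            (consecutive⇒next⊎prev cn)
      }
      where
      pa : position a ≡ prev γ
      pa = trans (cong position (sym p↦a)) (position-f (prev γ))

module CycleOfVertices {N} (G : Graph N) {M} (R : Fin (suc M) → Fin N)
  (R-adj : ∀ i → adj G (R i) (R (Cyclic.next i)) ≡ true) where

  open Cyclic {M}

  walk-around : ∀ {P} → (∀ i → P (R i)) → ∀ i j → Walk G P (R i) (R j)
  walk-around {P} P-R i j with reachable i j
  ... | d , refl = along d i
    where
    along : ∀ d i → Walk G P (R i) (R (next^ d i))
    along zero    i = here (P-R i)
    along (suc d) i = step (P-R i) (R-adj i) (along d (next i))

  exit : (S : Subset N) → ∀ {k i} → R k ∈ S → R i ∉ S →
         ∃ λ p → Walk G (outside G S) (R i) (R p) × R p ∉ S × R (next p) ∈ S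
  exit S {k} {i} k∈S i∉S with reachable i k
  ... | d , refl = go d i i∉S k∈S
    where
    go : ∀ d i → R i ∉ S → R (next^ d i) ∈ S →
         ∃ λ p → Walk G (outside G S) (R i) (R p) × R p ∉ S × R (next p) ∈ S
    go zero    i i∉S i∈S = ⊥-elim (i∉S i∈S)
    go (suc d) i i∉S d∈S with R (next i) ∈? S
    ... | yes next∈S = i , here i∉S , i∉S , next∈S
    ... | no  next∉S with go d (next i) next∉S d∈S
    ...   | p , w , p∉S , next-p∈S = p , step i∉S (R-adj i) w , p∉S , next-p∈S

-- The graph J n

module Jₙ (m : ℕ) (2≤m : 2 ≤ m) where

  n : ℕ
  n = suc m

  open Cyclic {m}

  V : Set
  V = Fin (3 * n)

  G : Graph (3 * n)
  G = J n

  T⇒≡true : ∀ {b} → T b → b ≡ true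
  T⇒≡true = Equivalence.to T-≡

  ≡true⇒T : ∀ {b} → b ≡ true → T b
  ≡true⇒T = Equivalence.from T-≡

  nextMod-next : ∀ i → nextMod n i (next i) ≡ true
  nextMod-next i = T⇒≡true (Equivalence.from T-∨ (by-step (next-step i)))
    where
    by-step : NextStep (toℕ i) (toℕ (next i)) →
              T (suc (toℕ i) ≡ᵇ toℕ (next i)) ⊎ T ((suc (toℕ i) ≡ᵇ n) ∧ (toℕ (next i) ≡ᵇ 0))
    by-step (inj₁ (_ , e))   = inj₁ (ℕP.≡⇒≡ᵇ _ _ (sym e))
    by-step (inj₂ (i≡m , e)) = inj₂ (Equivalence.from T-∧ (ℕP.≡⇒≡ᵇ _ _ (cong suc i≡m) , ℕP.≡⇒≡ᵇ _ _ e))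

  nextMod⇒next : ∀ i j → nextMod n i j ≡ true → j ≡ next i
  nextMod⇒next i j e = by-step (Equivalence.to T-∨ (≡true⇒T e)) (next-step i)
    where
    by-step : T (suc (toℕ i) ≡ᵇ toℕ j) ⊎ T ((suc (toℕ i) ≡ᵇ n) ∧ (toℕ j ≡ᵇ 0)) →
              NextStep (toℕ i) (toℕ (next i)) → j ≡ next i
    by-step (inj₁ t) (inj₁ (_ , s)) = FinP.toℕ-injective (trans (sym (ℕP.≡ᵇ⇒≡ _ _ t)) (sym s))
    by-step (inj₁ t) (inj₂ (i≡m , _)) =
      ⊥-elim (ℕP.<-irrefl (trans (sym (ℕP.≡ᵇ⇒≡ _ _ t)) (cong suc i≡m)) (FinP.toℕ<n j))
    by-step (inj₂ t) (inj₁ (i<m , _)) =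
      ⊥-elim (ℕP.<-irrefl (ℕP.suc-injective (ℕP.≡ᵇ⇒≡ _ _ (proj₁ (Equivalence.to T-∧ t)))) i<m)
    by-step (inj₂ t) (inj₂ (_ , s)) =
      FinP.toℕ-injective (trans (ℕP.≡ᵇ⇒≡ _ _ (proj₂ (Equivalence.to (T-∧ {suc (toℕ i) ≡ᵇ n}) t))) (sym s))

  cycAdj-sym : ∀ i j → cycAdj n i j ≡ cycAdj n j i
  cycAdj-sym i j = ∨-comm (nextMod n i j) (nextMod n j i)

  cycAdj-next : ∀ i → cycAdj n i (next i) ≡ true
  cycAdj-next i = cong (_∨ nextMod n (next i) i) (nextMod-next i)

  cycAdj-prev : ∀ i → cycAdj n i (prev i) ≡ true
  cycAdj-prev i = trans (cycAdj-sym i (prev i))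
                        (subst (λ j → cycAdj n (prev i) j ≡ true) (next-prev i) (cycAdj-next (prev i)))

  cycAdj⇒consecutive : ∀ i j → cycAdj n i j ≡ true → Consecutive i j
  cycAdj⇒consecutive i j e with Equivalence.to T-∨ (≡true⇒T e)
  ... | inj₁ t = inj₁ (nextMod⇒next i j (T⇒≡true t))
  ... | inj₂ t = inj₂ (nextMod⇒next j i (T⇒≡true t))

  sameIdx-refl : ∀ (i : Fin n) → sameIdx i i ≡ true
  sameIdx-refl i = T⇒≡true (ℕP.≡⇒≡ᵇ (toℕ i) (toℕ i) refl)

  sameIdx⇒≡ : ∀ (i j : Fin n) → sameIdx i j ≡ true → i ≡ j
  sameIdx⇒≡ i j e = FinP.toℕ-injective (ℕP.≡ᵇ⇒≡ _ _ (≡true⇒T e))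

  sameIdx-false : ∀ {i j : Fin n} → i ≢ j → sameIdx i j ≡ false
  sameIdx-false {i} {j} i≢j = ¬-not (i≢j ∘ sameIdx⇒≡ i j)

  sameIdx-sym : ∀ (i j : Fin n) → sameIdx i j ≡ sameIdx j i
  sameIdx-sym i j with i Fin.≟ j
  ... | yes refl = refl
  ... | no  i≢j  = trans (sameIdx-false i≢j) (sym (sameIdx-false (i≢j ∘ sym)))

  adjJ-sym : ∀ x y → adjJ n x y ≡ adjJ n y x
  adjJ-sym (0F , i) (0F , j) = cycAdj-sym i j
  adjJ-sym (0F , i) (1F , j) = sameIdx-sym i j
  adjJ-sym (0F , i) (2F , j) = sameIdx-sym i j
  adjJ-sym (1F , i) (0F , j) = sameIdx-sym i j
  adjJ-sym (1F , i) (1F , j) = cycAdj-sym i j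
  adjJ-sym (1F , i) (2F , j) = sameIdx-sym i j
  adjJ-sym (2F , i) (0F , j) = sameIdx-sym i j
  adjJ-sym (2F , i) (1F , j) = sameIdx-sym i j
  adjJ-sym (2F , i) (2F , j) = refl

  J-sym : SymmetricAdjacency G
  J-sym u v e = trans (adjJ-sym (remQuot n v) (remQuot n u)) e

  sameIdx-indicator : ∀ (i j : Fin n) → indicator (sameIdx i j) ≡ δ i j
  sameIdx-indicator i j with i Fin.≟ j
  ... | yes refl = cong indicator (sameIdx-refl i)
  ... | no  i≢j  = cong indicator (sameIdx-false i≢j)

  cycAdj-indicator : ∀ i j → indicator (cycAdj n i j) ≡ δ (next i) j + δ (prev i) j
  cycAdj-indicator i j with next i Fin.≟ j | prev i Fin.≟ j
  ... | yes refl | yes p≡n = ⊥-elim (next≢prev 2≤m i (sym p≡n))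
  ... | yes refl | no _    = cong indicator (cycAdj-next i)
  ... | no _     | yes refl = cong indicator (cycAdj-prev i)
  ... | no n≢j   | no p≢j  = cong indicator (¬-not (Data.Sum.[ n≢j ∘ sym , p≢j ∘ sym ]
                                                     ∘ consecutive⇒next⊎prev ∘ cycAdj⇒consecutive i j))

  opaque
    vertex : Fin 3 → Fin n → V
    vertex = combine

    adj-vertex : ∀ s i t j → adj G (vertex s i) (vertex t j) ≡ adjJ n (s , i) (t , j)
    adj-vertex s i t j rewrite FinP.remQuot-combine {3} {n} s i | FinP.remQuot-combine {3} {n} t j = refl

    remQuot-vertex : ∀ t i → remQuot n (vertex t i) ≡ (t , i)
    remQuot-vertex = FinP.remQuot-combine

    vertex-injective : ∀ {s i t j} → vertex s i ≡ vertex t j → s ≡ t × i ≡ j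
    vertex-injective {s} {i} {t} {j} e with trans (sym (remQuot-vertex s i)) (trans (cong (remQuot n) e) (remQuot-vertex t j))
    ... | refl = refl , refl

  data View : V → Set where
    at : ∀ t i → View (vertex t i)

  opaque
    unfolding vertex

    view : ∀ u → View u
    view u = subst View (FinP.combine-remQuot {3} n u) (at (proj₁ (remQuot {3} n u)) (proj₂ (remQuot {3} n u)))

  A B C : Fin n → V
  A = vertex 0F
  B = vertex 1F
  C = vertex 2F

  -- δ on (type , index) pairs, written so that it computes to 0 or δ i j for concrete s and t
  δ-pair : Fin 3 × Fin n → Fin 3 × Fin n → ℕ
  δ-pair (s , i) (t , j) = if does (s Fin.≟ t) then δ i j else 0

  δ-vertex : ∀ s i t j → δ (vertex s i) (vertex t j) ≡ δ-pair (s , i) (t , j)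
  δ-vertex s i t j with s Fin.≟ t
  ... | no s≢t   = δ-≢ (s≢t ∘ proj₁ ∘ vertex-injective)
  ... | yes refl with i Fin.≟ j
  ...   | yes refl = δ-refl (vertex s i)
  ...   | no  i≢j  = δ-≢ (i≢j ∘ proj₂ ∘ vertex-injective)

  neighbours : Fin 3 → Fin n → List (Fin 3 × Fin n)
  neighbours 0F i = (0F , next i) ∷ (0F , prev i) ∷ (1F , i) ∷ (2F , i) ∷ []
  neighbours 1F i = (1F , next i) ∷ (1F , prev i) ∷ (0F , i) ∷ (2F , i) ∷ []
  neighbours 2F i = (0F , i) ∷ (1F , i) ∷ []

  occurrences : List (Fin 3 × Fin n) → Fin 3 × Fin n → ℕ
  occurrences ps q = ListAction.sum (List.map (λ p → δ-pair p q) ps)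

  adjJ-indicator : ∀ s i t j → indicator (adjJ n (s , i) (t , j)) ≡ occurrences (neighbours s i) (t , j)
  adjJ-indicator 0F i 0F j = trans (cycAdj-indicator i j) (cong (δ (next i) j +_) (sym (ℕP.+-identityʳ _)))
  adjJ-indicator 0F i 1F j = trans (sameIdx-indicator i j) (sym (ℕP.+-identityʳ _))
  adjJ-indicator 0F i 2F j = trans (sameIdx-indicator i j) (sym (ℕP.+-identityʳ _))
  adjJ-indicator 1F i 0F j = trans (sameIdx-indicator i j) (sym (ℕP.+-identityʳ _))
  adjJ-indicator 1F i 1F j = trans (cycAdj-indicator i j) (cong (δ (next i) j +_) (sym (ℕP.+-identityʳ _)))
  adjJ-indicator 1F i 2F j = trans (sameIdx-indicator i j) (sym (ℕP.+-identityʳ _))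
  adjJ-indicator 2F i 0F j = trans (sameIdx-indicator i j) (sym (ℕP.+-identityʳ _))
  adjJ-indicator 2F i 1F j = trans (sameIdx-indicator i j) (sym (ℕP.+-identityʳ _))
  adjJ-indicator 2F i 2F j = refl

  multiplicity-vertices : ∀ ps t j → multiplicity (List.map (λ (s , i) → vertex s i) ps) (vertex t j) ≡ occurrences ps (t , j)
  multiplicity-vertices []             t j = refl
  multiplicity-vertices ((s , i) ∷ ps) t j = cong₂ _+_ (δ-vertex s i t j) (multiplicity-vertices ps t j)

  degree-vertex : ∀ s i → degree G (vertex s i) ≡ List.length (neighbours s i)
  degree-vertex s i = trans (degree≡length G (vertex s i) (List.map (λ (t , j) → vertex t j) (neighbours s i)) pointwise)
                            (ListP.length-map _ (neighbours s i))
    where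
    pointwise : ∀ v → indicator (adj G (vertex s i) v) ≡ multiplicity (List.map (λ (t , j) → vertex t j) (neighbours s i)) v
    pointwise v with view v
    ... | at t j = trans (cong indicator (adj-vertex s i t j))
                         (trans (adjJ-indicator s i t j) (sym (multiplicity-vertices (neighbours s i) t j)))

  degree-even : ∀ u → 2 ∣ degree G u
  degree-even u with view u
  ... | at 0F i = subst (2 ∣_) (sym (degree-vertex 0F i)) (divides 2 refl)
  ... | at 1F i = subst (2 ∣_) (sym (degree-vertex 1F i)) (divides 2 refl)
  ... | at 2F i = subst (2 ∣_) (sym (degree-vertex 2F i)) (divides 1 refl)

  adj-same-index : ∀ {s t} i → s ≢ t → adj G (vertex s i) (vertex t i) ≡ true
  adj-same-index {s} {t} i s≢t = trans (adj-vertex s i t i) (same s t s≢t)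
    where
    same : ∀ s t → s ≢ t → adjJ n (s , i) (t , i) ≡ true
    same 0F 0F s≢t = ⊥-elim (s≢t refl)
    same 0F 1F _   = sameIdx-refl i
    same 0F 2F _   = sameIdx-refl i
    same 1F 0F _   = sameIdx-refl i
    same 1F 1F s≢t = ⊥-elim (s≢t refl)
    same 1F 2F _   = sameIdx-refl i
    same 2F 0F _   = sameIdx-refl i
    same 2F 1F _   = sameIdx-refl i
    same 2F 2F s≢t = ⊥-elim (s≢t refl)

  Row : Fin 3 → Set
  Row t = t ≢ 2F

  row-adj : ∀ {t} → Row t → ∀ i → adj G (vertex t i) (vertex t (next i)) ≡ true
  row-adj {0F} _   i = trans (adj-vertex 0F i 0F (next i)) (cycAdj-next i)
  row-adj {1F} _   i = trans (adj-vertex 1F i 1F (next i)) (cycAdj-next i)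
  row-adj {2F} row i = ⊥-elim (row refl)

  C-neighbours : ∀ i w → adj G (C i) w ≡ true → w ≡ A i ⊎ w ≡ B i
  C-neighbours i w e with view w
  ... | at 0F j = inj₁ (cong A (sym (sameIdx⇒≡ i j (trans (sym (adj-vertex 2F i 0F j)) e))))
  ... | at 1F j = inj₂ (cong B (sym (sameIdx⇒≡ i j (trans (sym (adj-vertex 2F i 1F j)) e))))
  ... | at 2F j with () ← trans (sym (adj-vertex 2F i 2F j)) e

  A-neighbours : ∀ i w → adj G (A i) w ≡ true → w ≡ B i ⊎ w ≡ C i ⊎ ∃ λ j → w ≡ A j × Consecutive i j
  A-neighbours i w e with view w
  ... | at 0F j = inj₂ (inj₂ (j , refl , cycAdj⇒consecutive i j (trans (sym (adj-vertex 0F i 0F j)) e)))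
  ... | at 1F j = inj₁ (cong B (sym (sameIdx⇒≡ i j (trans (sym (adj-vertex 0F i 1F j)) e))))
  ... | at 2F j = inj₂ (inj₁ (cong C (sym (sameIdx⇒≡ i j (trans (sym (adj-vertex 0F i 2F j)) e)))))

  module _ {t} (row : Row t) where
    open CycleOfVertices G (vertex t) (row-adj row) public

    walk-to-row : ∀ {P} → (∀ i → P (vertex t i)) → ∀ u → P u → Walk G P u (vertex t 0F)
    walk-to-row P-row u Pu with view u
    ... | at s i with s Fin.≟ t
    ...   | yes refl = walk-around P-row i 0F
    ...   | no  s≢t  = step Pu (adj-same-index i s≢t) (walk-around P-row i 0F)

  a-row : Row 0F
  a-row ()

  b-row : Row 1F
  b-row ()

  connected : Connected G
  connected u v = walk-to-row a-row _ u tt ++ reverse J-sym (walk-to-row a-row _ v tt)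

  module Marks (S : Subset (3 * n)) where

    Marked : (V → V) → V → Set
    Marked anchor u = Σ V λ x → x ∈ S × Walk G (outside G S) u (anchor x)

    anchorA : Fin n → V
    anchorA i with A (prev i) ∈? S
    ... | yes _ = C i
    ... | no  _ = A (prev i)

    anchorB : Fin n → V
    anchorB i with A i ∈? S | A (prev i) ∈? S
    ... | yes _ | no _ = C i
    ... | _     | _    = B (prev i)

    anchorAt : Fin 3 × Fin n → V
    anchorAt (0F , i) = anchorA i
    anchorAt (1F , i) = anchorB i
    anchorAt (2F , i) = C i   -- c-vertices are never marks

    anchor : V → V
    anchor u = anchorAt (remQuot n u)

    anchorA-C : ∀ {i} → A (prev i) ∈ S → anchor (A i) ≡ C i
    anchorA-C {i} a∈S rewrite remQuot-vertex 0F i with A (prev i) ∈? S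
    ... | yes _   = refl
    ... | no  a∉S = ⊥-elim (a∉S a∈S)

    anchorA-A : ∀ {i} → A (prev i) ∉ S → anchor (A i) ≡ A (prev i)
    anchorA-A {i} a∉S rewrite remQuot-vertex 0F i with A (prev i) ∈? S
    ... | yes a∈S = ⊥-elim (a∉S a∈S)
    ... | no  _   = refl

    anchorB-C : ∀ {i} → A i ∈ S → A (prev i) ∉ S → anchor (B i) ≡ C i
    anchorB-C {i} a∈S a′∉S rewrite remQuot-vertex 1F i with A i ∈? S | A (prev i) ∈? S
    ... | yes _   | no _     = refl
    ... | yes _   | yes a′∈S = ⊥-elim (a′∉S a′∈S)
    ... | no  a∉S | _        = ⊥-elim (a∉S a∈S)

    anchorB-B : ∀ {i} → ¬ (A i ∈ S × A (prev i) ∉ S) → anchor (B i) ≡ B (prev i)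
    anchorB-B {i} ¬C rewrite remQuot-vertex 1F i with A i ∈? S | A (prev i) ∈? S
    ... | yes a∈S | no a′∉S = ⊥-elim (¬C (a∈S , a′∉S))
    ... | yes _   | yes _   = refl
    ... | no  _   | _       = refl

    mark-A : ∀ {u p} → Walk G (outside G S) u (A p) → A p ∉ S → A (next p) ∈ S → Marked anchor u
    mark-A {p = p} w p∉S next∈S = A (next p) , next∈S , subst (Walk G (outside G S) _) (sym anchor≡) w
      where
      anchor≡ : anchor (A (next p)) ≡ A p
      anchor≡ = trans (anchorA-A (subst (λ j → A j ∉ S) (sym (prev-next p)) p∉S)) (cong A (prev-next p))

    mark-B-here : ∀ {u p} → ¬ (A (next p) ∈ S × A p ∉ S) →
                  Walk G (outside G S) u (B p) → B (next p) ∈ S → Marked anchor u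
    mark-B-here {p = p} ¬C w next∈S = B (next p) , next∈S , subst (Walk G (outside G S) _) (sym anchor≡) w
      where
      anchor≡ : anchor (B (next p)) ≡ B p
      anchor≡ = trans (anchorB-B (subst (λ j → ¬ (A (next p) ∈ S × A j ∉ S)) (sym (prev-next p)) ¬C))
                      (cong B (prev-next p))

    mark-B : ∀ {u p} → Walk G (outside G S) u (B p) → B p ∉ S → B (next p) ∈ S → Marked anchor u
    mark-B {p = p} w p∉S next∈S with A (next p) ∈? S | A p ∈? S
    ... | yes a-next∈S | no  a∉S = mark-A (w ++ edge p∉S a∉S (adj-same-index p λ ())) a∉S a-next∈S
    ... | yes _        | yes a∈S = mark-B-here (λ (_ , a∉S) → a∉S a∈S) w next∈S
    ... | no a-next∉S  | _       = mark-B-here (λ (a-next∈S , _) → a-next∉S a-next∈S) w next∈S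

    mark-C : ∀ {i} → C i ∉ S → A i ∈ S → B i ∈ S → Marked anchor (C i)
    mark-C {i} c∉S a∈S b∈S with A (prev i) ∈? S
    ... | yes a′∈S = A i , a∈S , subst (Walk G (outside G S) (C i)) (sym (anchorA-C a′∈S)) (here c∉S)
    ... | no  a′∉S = B i , b∈S , subst (Walk G (outside G S) (C i)) (sym (anchorB-C a∈S a′∉S)) (here c∉S)

    module _ {ka kb} (ka∈S : A ka ∈ S) (kb∈S : B kb ∈ S) where

      mark-via-A : ∀ {u i} → Walk G (outside G S) u (A i) → A i ∉ S → Marked anchor u
      mark-via-A w a∉S with exit a-row S ka∈S a∉S
      ... | p , w′ , p∉S , next∈S = mark-A (w ++ w′) p∉S next∈S

      mark-via-B : ∀ {u i} → Walk G (outside G S) u (B i) → B i ∉ S → Marked anchor u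
      mark-via-B w b∉S with exit b-row S kb∈S b∉S
      ... | p , w′ , p∉S , next∈S = mark-B (w ++ w′) p∉S next∈S

      marked : ∀ u → u ∉ S → Marked anchor u
      marked u u∉S with view u
      ... | at 0F i = mark-via-A (here u∉S) u∉S
      ... | at 1F i = mark-via-B (here u∉S) u∉S
      ... | at 2F i with A i ∈? S | B i ∈? S
      ...   | no  a∉S | _       = mark-via-A (edge u∉S a∉S (adj-same-index i λ ())) a∉S
      ...   | yes _   | no  b∉S = mark-via-B (edge u∉S b∉S (adj-same-index i λ ())) b∉S
      ...   | yes a∈S | yes b∈S = mark-C u∉S a∈S b∈S

  marking : (S : Subset (3 * n)) → Nonempty S → Σ (V → V) λ anchor → ∀ u → u ∉ S → Marks.Marked S anchor u
  marking S (s₀ , s₀∈S) with FinP.any? (λ i → A i ∈? S) | FinP.any? (λ i → B i ∈? S)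
  ... | no  ∄a           | _              =
    (λ _ → A 0F) , λ u u∉S → s₀ , s₀∈S , walk-to-row a-row (λ i a∈S → ∄a (i , a∈S)) u u∉S
  ... | yes _            | no  ∄b         =
    (λ _ → B 0F) , λ u u∉S → s₀ , s₀∈S , walk-to-row b-row (λ i b∈S → ∄b (i , b∈S)) u u∉S
  ... | yes (_ , ka∈S)   | yes (_ , kb∈S) = Marks.anchor S , Marks.marked S ka∈S kb∈S

  tough : Tough G
  tough = connected , λ S S≢∅ → let anchor , marked = marking S S≢∅ in components≤∣S∣ G J-sym S anchor marked

  ¬hamiltonian : ¬ (2 ∣ n) → ¬ Hamiltonian G
  ¬hamiltonian odd (_ , f , f-injective , f-step , f-wrap) =
    odd-cycle-has-no-perfect-matching 2≤m odd partner partner-consecutive partner-involutive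
    where
    open HamiltonianCycle G J-sym f f-injective f-step f-wrap
    open Continuation

    3≤3n-1 : 3 ≤ ℕ.pred (3 * n)
    3≤3n-1 = ℕP.+-mono-≤ 2≤m (s≤s z≤n)

    -- opaque, or unification would unfold the search for positions inside continuation i
    opaque
      continuation : ∀ i → Continuation (A i) (B i) (C i)
      continuation i = through-degree-two 3≤3n-1 (C-neighbours i)

    partner-spec : ∀ i → ∃ λ j → beyond (continuation i) ≡ A j × Consecutive i j
    partner-spec i = classify (A-neighbours i _ (cycleNeighbours⇒adj (beyond-neighbour (continuation i))))
      where
      u = beyond (continuation i)
      classify : u ≡ B i ⊎ u ≡ C i ⊎ (∃ λ j → u ≡ A j × Consecutive i j) → ∃ λ j → u ≡ A j × Consecutive i j
      classify (inj₁ u≡b)          = ⊥-elim (beyond≢b (continuation i) u≡b)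
      classify (inj₂ (inj₁ u≡c))   = ⊥-elim (beyond≢c (continuation i) u≡c)
      classify (inj₂ (inj₂ found)) = found

    partner : Fin n → Fin n
    partner i = proj₁ (partner-spec i)

    partner-consecutive : ∀ i → Consecutive i (partner i)
    partner-consecutive i = proj₂ (proj₂ (partner-spec i))

    beyond-partner : ∀ i → beyond (continuation i) ≡ A (partner i)
    beyond-partner i = proj₁ (proj₂ (partner-spec i))

    partner-involutive : ∀ i → partner (partner i) ≡ i
    partner-involutive i = classify (neighbours-of-a (continuation j) (A i) back)
      where
      j = partner i
      back : CycleNeighbours (A j) (A i)
      back = cycleNeighbours-sym (subst (CycleNeighbours (A i)) (beyond-partner i) (beyond-neighbour (continuation i)))
      classify : A i ≡ C j ⊎ A i ≡ beyond (continuation j) → partner j ≡ i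
      classify (inj₁ a≡c) = case proj₁ (vertex-injective a≡c) of λ ()
      classify (inj₂ a≡u) = sym (proj₂ (vertex-injective (trans a≡u (beyond-partner j))))

  harris : ¬ (2 ∣ n) → Harris G
  harris odd = tough , (connected , degree-even) , ¬hamiltonian odd

mainTheorem5 : (n : ℕ) → 3 ≤ n → ¬ (2 ∣ n) → Harris (J n)
mainTheorem5 (suc m) (s≤s 2≤m) = Jₙ.harris m 2≤m
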